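{- For every positive integer $n$, $|T(n+1)|\ge 6^{n/2}|T(n)|$, where $T(m)$ denotes the set of bitournaments on the vertex set $\{0,\ldots,m-1\}$.
   Context: A digraph is a pair $(G,E)$ with $E\subseteq G\times G$ such that $(g,g)\notin E$ for all $g$, and $(g,g')\in E$ implies $(g',g)\notin E$. A tournament is a digraph in which any two distinct vertices are joined by an arrow in exactly one direction. A bitournament is a digraph whose vertex set can be partitioned into two sets each inducing a tournament (arrows between the two parts are allowed). Bitournaments are labelled, i.e. counted as distinct arrow sets on the given vertex set. -}

module Defs where

open import Data.Bool using (Bool; true; false)
import Data.Bool.Properties as BoolP
open import Data.Nat using (ℕ; zero; suc)
open import Data.Fin using (Fin)
import Data.Fin.Properties as FinP
open import Data.Fin.Subset using (Subset; _∈_; ∁)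
open import Data.Fin.Subset.Properties using (_∈?_; anySubset?)
open import Data.Vec using (Vec; []; _∷_; lookup)
open import Data.List using (List; []; _∷_; length; filter; concatMap; map)
open import Data.Product using (_×_; ∃)
open import Data.Sum using (_⊎_)
open import Relation.Nullary using (¬_; Dec; ¬?)
open import Relation.Nullary.Decidable using (_×-dec_; _⊎-dec_; _→-dec_)
open import Relation.Binary.PropositionalEquality using (_≡_; _≢_)

Adj : ℕ → Set
Adj m = Vec (Vec Bool m) m

Arrow : ∀ {m} → Adj m → Fin m → Fin m → Set
Arrow A i j = lookup (lookup A i) j ≡ true

IsDigraph : ∀ {m} → Adj m → Set
IsDigraph {m} A =
  (∀ (i : Fin m) → ¬ Arrow A i i) ×
  (∀ (i j : Fin m) → Arrow A i j → ¬ Arrow A j i)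

-- The vertex subset S induces a tournament: any two distinct vertices of S
-- are joined by an arrow (in exactly one direction, by asymmetry).
InducesTournament : ∀ {m} → Adj m → Subset m → Set
InducesTournament {m} A S =
  ∀ (i j : Fin m) → i ∈ S → j ∈ S → i ≢ j → Arrow A i j ⊎ Arrow A j i

-- Bitournament: a digraph whose vertex set splits into S and its complement,
-- each inducing a tournament (parts may be empty).
IsBitournament : ∀ {m} → Adj m → Set
IsBitournament A =
  IsDigraph A × ∃ λ S → InducesTournament A S × InducesTournament A (∁ S)

arrow? : ∀ {m} (A : Adj m) i j → Dec (Arrow A i j)
arrow? A i j = lookup (lookup A i) j BoolP.≟ true

isDigraph? : ∀ {m} (A : Adj m) → Dec (IsDigraph A)
isDigraph? A =
  FinP.all? (λ i → ¬? (arrow? A i i)) ×-dec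
  FinP.all? (λ i → FinP.all? (λ j → arrow? A i j →-dec ¬? (arrow? A j i)))

tour? : ∀ {m} (A : Adj m) S → Dec (InducesTournament A S)
tour? A S = FinP.all? λ i → FinP.all? λ j →
  (i ∈? S) →-dec ((j ∈? S) →-dec (¬? (i FinP.≟ j) →-dec
     (arrow? A i j ⊎-dec arrow? A j i)))

isBitournament? : ∀ {m} (A : Adj m) → Dec (IsBitournament A)
isBitournament? A =
  isDigraph? A ×-dec anySubset? (λ S → tour? A S ×-dec tour? A (∁ S))

allVecs : ∀ {a} {X : Set a} → List X → (n : ℕ) → List (Vec X n)
allVecs xs zero    = [] ∷ []
allVecs xs (suc n) = concatMap (λ x → map (x ∷_) (allVecs xs n)) xs

allAdj : (m : ℕ) → List (Adj m)
allAdj m = allVecs (allVecs (true ∷ false ∷ []) m) m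

numBitournaments : ℕ → ℕ
numBitournaments m = length (filter isBitournament? (allAdj m))

-- Fix a split V = S ⊎ ∁ S of a bitournament on n vertices into two tournaments and
-- add a new vertex to the part S. Towards each old vertex of S the new vertex has an
-- outgoing or an incoming arrow, towards each vertex of ∁ S it may also have none, so
-- the bitournament extends in 2^|S| 3^(n-|S|) ways, and the choice of S or ∁ S making
-- this number larger gives at least 6^(n/2) extensions, because the two numbers
-- multiply to 6^n. Distinct pairs (bitournament, extension data) give distinct
-- bitournaments on n + 1 vertices, and squaring the resulting count turns
-- 6^(n/2) into the integral bound 6^n.
module Submission where

open import Defs
open import Data.Bool using (Bool; true; false; not)
open import Data.Bool.Properties using (not-involutive)
open import Data.Empty using (⊥-elim)
open import Function using (_∘_)
open import Data.Fin using (zero; suc)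
open import Data.Fin.Subset using (Subset; _∈_; ∁)
open import Data.List using (List; []; _∷_; [_]; length; filter; concatMap; map; _++_; cartesianProductWith)
open import Data.List.Membership.Propositional using (find) renaming (_∈_ to _∈ₗ_)
open import Data.List.Membership.Propositional.Properties
  using (∈-map⁻; ∈-concatMap⁻; ∈-filter⁺; ∈-filter⁻; ∈-∃++; ∈-++⁺ˡ; ∈-++⁺ʳ; ∈-++⁻;
         ∈-cartesianProductWith⁺; ∈-cartesianProductWith⁻)
open import Data.List.Properties using (length-++; length-map)
open import Data.List.Relation.Binary.Subset.Propositional using (_⊆_)
import Data.List.Relation.Unary.All as All
import Data.List.Relation.Unary.All.Properties as All
open import Data.List.Relation.Unary.AllPairs using ([]; _∷_)
import Data.List.Relation.Unary.AllPairs as AllPairs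
import Data.List.Relation.Unary.AllPairs.Properties as AllPairs
open import Data.List.Relation.Unary.Any using (here; there)
open import Data.List.Relation.Unary.Unique.Propositional using (Unique)
import Data.List.Relation.Unary.Unique.Propositional.Properties as Unique
open import Data.Nat using (ℕ; zero; suc; _+_; _*_; _^_; _≤_; _≤?_; s≤s; z≤n)
open import Data.Nat.ListAction using (sum)
open import Data.Nat.Properties
open import Data.Nat.Tactic.RingSolver using (solve-∀)
open import Data.Product using (_×_; _,_; proj₁; proj₂)
open import Data.Sum using (_⊎_; inj₁; inj₂; swap)
open import Data.Vec using (Vec; []; _∷_; lookup; zipWith; head; tail; replicate)
import Data.Vec as Vec
open import Data.Vec.Properties using (lookup-zipWith; lookup-map; ∷-injective)
open import Relation.Nullary using (¬_; yes; no)
open import Relation.Binary.PropositionalEquality using (_≡_; _≢_; refl; sym; trans; cong; cong₂; subst; module ≡-Reasoning)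

length-concatMap : ∀ {A B : Set} (f : A → List B) (xs : List A) →
  length (concatMap f xs) ≡ sum (map (length ∘ f) xs)
length-concatMap f []       = refl
length-concatMap f (x ∷ xs) = trans (length-++ (f x)) (cong (length (f x) +_) (length-concatMap f xs))

length-cartesianProductWith : ∀ {A B C : Set} (f : A → B → C) (xs : List A) (ys : List B) →
  length (cartesianProductWith f xs ys) ≡ length xs * length ys
length-cartesianProductWith f []       ys = refl
length-cartesianProductWith f (x ∷ xs) ys =
  trans (length-++ (map (f x) ys)) (cong₂ _+_ (length-map (f x) ys) (length-cartesianProductWith f xs ys))

concatMap-map≡cartesianProductWith : ∀ {A B C : Set} (f : A → B → C) (xs : List A) (ys : List B) →
  concatMap (λ x → map (f x) ys) xs ≡ cartesianProductWith f xs ys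
concatMap-map≡cartesianProductWith f []       ys = refl
concatMap-map≡cartesianProductWith f (x ∷ xs) ys =
  cong (map (f x) ys ++_) (concatMap-map≡cartesianProductWith f xs ys)

Unique-concatMap⁺ : ∀ {A B : Set} (f : A → List B) {xs : List A} → Unique xs →
  (∀ x → Unique (f x)) → (∀ {x y z} → z ∈ₗ f x → z ∈ₗ f y → x ≡ y) →
  Unique (concatMap f xs)
Unique-concatMap⁺ f xs! f! f-disjoint =
  Unique.concat⁺ (All.map⁺ (All.tabulate (λ {x} _ → f! x)))
    (AllPairs.map⁺ (AllPairs.map (λ x≢y {_} (z∈fx , z∈fy) → x≢y (f-disjoint z∈fx z∈fy)) xs!))

Unique-⊆⇒length≤ : ∀ {A : Set} {xs ys : List A} → Unique xs → xs ⊆ ys → length xs ≤ length ys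
Unique-⊆⇒length≤ {xs = []}     _            _     = z≤n
Unique-⊆⇒length≤ {xs = x ∷ xs} (x∉xs ∷ xs!) x∷xs⊆ys with ∈-∃++ (x∷xs⊆ys (here refl))
... | as , bs , refl = begin
  suc (length xs)             ≤⟨ s≤s (Unique-⊆⇒length≤ xs! xs⊆as++bs) ⟩
  suc (length (as ++ bs))     ≡⟨ cong suc (length-++ as) ⟩
  suc (length as + length bs) ≡⟨ +-suc (length as) (length bs) ⟨
  length as + length (x ∷ bs) ≡⟨ length-++ as ⟨
  length (as ++ x ∷ bs)       ∎
  where
  open ≤-Reasoning
  xs⊆as++bs : xs ⊆ as ++ bs
  xs⊆as++bs {z} z∈xs with ∈-++⁻ as (x∷xs⊆ys (there z∈xs))
  ... | inj₁ z∈as         = ∈-++⁺ˡ z∈as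
  ... | inj₂ (here refl)  = ⊥-elim (All.lookup x∉xs z∈xs refl)
  ... | inj₂ (there z∈bs) = ∈-++⁺ʳ as z∈bs

allVecs-suc : ∀ {X : Set} (xs : List X) n → allVecs xs (suc n) ≡ cartesianProductWith _∷_ xs (allVecs xs n)
allVecs-suc xs n = concatMap-map≡cartesianProductWith _∷_ xs (allVecs xs n)

∈-allVecs : ∀ {X : Set} {xs : List X} → (∀ x → x ∈ₗ xs) → ∀ {n} (v : Vec X n) → v ∈ₗ allVecs xs n
∈-allVecs xs-complete []                 = here refl
∈-allVecs {xs = xs} xs-complete {suc n} (x ∷ v) rewrite allVecs-suc xs n =
  ∈-cartesianProductWith⁺ _∷_ (xs-complete x) (∈-allVecs xs-complete v)

Unique-allVecs : ∀ {X : Set} {xs : List X} → Unique xs → ∀ n → Unique (allVecs xs n)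
Unique-allVecs xs! zero = All.[] ∷ []
Unique-allVecs {xs = xs} xs! (suc n) rewrite allVecs-suc xs n =
  Unique.cartesianProductWith⁺ _∷_ ∷-injective xs! (Unique-allVecs xs! n)

∈-booleans : ∀ b → b ∈ₗ true ∷ false ∷ []
∈-booleans true  = here refl
∈-booleans false = there (here refl)

Unique-booleans : Unique (true ∷ false ∷ [])
Unique-booleans = ((λ ()) All.∷ All.[]) ∷ All.[] ∷ []

∈-allAdj : ∀ {m} (A : Adj m) → A ∈ₗ allAdj m
∈-allAdj = ∈-allVecs (∈-allVecs ∈-booleans)

Unique-allAdj : ∀ m → Unique (allAdj m)
Unique-allAdj m = Unique-allVecs (Unique-allVecs Unique-booleans m) m

bitournaments : (m : ℕ) → List (Adj m)
bitournaments m = filter isBitournament? (allAdj m)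

data Link : Set where
  outgoing incoming absent : Link

isOutgoing : Link → Bool
isOutgoing outgoing = true
isOutgoing _        = false

isIncoming : Link → Bool
isIncoming incoming = true
isIncoming _        = false

linkChoices : Bool → List Link
linkChoices true  = outgoing ∷ incoming ∷ []
linkChoices false = outgoing ∷ incoming ∷ absent ∷ []

Unique-linkChoices : ∀ s → Unique (linkChoices s)
Unique-linkChoices true  = ((λ ()) All.∷ All.[]) ∷ All.[] ∷ []
Unique-linkChoices false = ((λ ()) All.∷ (λ ()) All.∷ All.[]) ∷ ((λ ()) All.∷ All.[]) ∷ All.[] ∷ []

∈-linkChoices-true⇒≢absent : ∀ {l} → l ∈ₗ linkChoices true → l ≢ absent
∈-linkChoices-true⇒≢absent (here refl)         ()
∈-linkChoices-true⇒≢absent (there (here refl)) ()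

-- The ways to join a new vertex that is to lie in the part S.
linkings : ∀ {n} → Subset n → List (Vec Link n)
linkings []      = [ [] ]
linkings (s ∷ S) = cartesianProductWith _∷_ (linkChoices s) (linkings S)

LinkedTo : ∀ {n} → Subset n → Vec Link n → Set
LinkedTo S r = ∀ j → j ∈ S → lookup r j ≢ absent

Unique-linkings : ∀ {n} (S : Subset n) → Unique (linkings S)
Unique-linkings []      = All.[] ∷ []
Unique-linkings (s ∷ S) = Unique.cartesianProductWith⁺ _∷_ ∷-injective (Unique-linkChoices s) (Unique-linkings S)

∈-linkings⇒LinkedTo : ∀ {n} (S : Subset n) {r} → r ∈ₗ linkings S → LinkedTo S r
∈-linkings⇒LinkedTo (s ∷ S) r∈ j j∈S with ∈-cartesianProductWith⁻ _∷_ (linkChoices s) (linkings S) r∈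
∈-linkings⇒LinkedTo (s ∷ S) r∈ zero    Vec.here        | _ , _ , l∈ , _   , refl = ∈-linkChoices-true⇒≢absent l∈
∈-linkings⇒LinkedTo (s ∷ S) r∈ (suc j) (Vec.there j∈S) | _ , _ , _  , r′∈ , refl = ∈-linkings⇒LinkedTo S r′∈ j j∈S

length-linkings-∁ : ∀ {n} (S : Subset n) → length (linkings S) * length (linkings (∁ S)) ≡ 6 ^ n
length-linkings-∁ []      = refl
length-linkings-∁ {suc n} (s ∷ S) = begin
  length (linkings (s ∷ S)) * length (linkings (not s ∷ ∁ S))
    ≡⟨ cong₂ _*_ (length-cartesianProductWith _∷_ (linkChoices s) (linkings S))
                 (length-cartesianProductWith _∷_ (linkChoices (not s)) (linkings (∁ S))) ⟩
  (length (linkChoices s) * a) * (length (linkChoices (not s)) * b)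
    ≡⟨ choices-product s a b ⟩
  6 * (a * b)
    ≡⟨ cong (6 *_) (length-linkings-∁ S) ⟩
  6 * 6 ^ n ∎
  where
  open ≡-Reasoning
  a = length (linkings S)
  b = length (linkings (∁ S))
  choices-product : ∀ s (x y : ℕ) → (length (linkChoices s) * x) * (length (linkChoices (not s)) * y) ≡ 6 * (x * y)
  choices-product true  = solve-∀
  choices-product false = solve-∀

square-cancel : ∀ {x y} → x * x ≤ y * y → x ≤ y
square-cancel x²≤y² = ≮⇒≥ (λ y<x → <⇒≱ (*-mono-< y<x y<x) x²≤y²)

≤-square-of-larger-factor : ∀ {a b c} → a * b ≡ c → b ≤ a → c ≤ a * a
≤-square-of-larger-factor {a} refl b≤a = *-monoʳ-≤ a b≤a

-- A weak Cauchy–Schwarz: each cross term w x · w y is ≥ c as well.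
sum-square-≥ : ∀ {A : Set} c (w : A → ℕ) (xs : List A) → (∀ x → c ≤ w x * w x) →
  c * (length xs * length xs) ≤ sum (map w xs) * sum (map w xs)
sum-square-≥ c w []       _    = ≤-reflexive (*-zeroʳ c)
sum-square-≥ c w (x ∷ xs) c≤w² = begin
  c * (suc k * suc k)              ≡⟨ expand-left c k ⟩
  c + 2 * (c * k) + c * (k * k)    ≤⟨ +-mono-≤ (+-mono-≤ (c≤w² x) (*-monoʳ-≤ 2 cross)) ih ⟩
  a * a + 2 * (a * s) + s * s      ≡⟨ expand-right a s ⟨
  (a + s) * (a + s)                ∎
  where
  open ≤-Reasoning
  k = length xs
  a = w x
  s = sum (map w xs)
  ih : c * (k * k) ≤ s * s
  ih = sum-square-≥ c w xs c≤w²
  expand-left : ∀ m n → m * ((1 + n) * (1 + n)) ≡ m + 2 * (m * n) + m * (n * n)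
  expand-left = solve-∀
  expand-right : ∀ m n → (m + n) * (m + n) ≡ m * m + 2 * (m * n) + n * n
  expand-right = solve-∀
  square-* : ∀ m n → (m * n) * (m * n) ≡ (m * m) * (n * n)
  square-* = solve-∀
  c-factor : ∀ m n → (m * n) * (m * n) ≡ m * (m * (n * n))
  c-factor = solve-∀
  cross : c * k ≤ a * s
  cross = square-cancel (begin
    (c * k) * (c * k)      ≡⟨ c-factor c k ⟩
    c * (c * (k * k))      ≤⟨ *-mono-≤ (c≤w² x) ih ⟩
    (a * a) * (s * s)      ≡⟨ square-* a s ⟨
    (a * s) * (a * s)      ∎)

addColumn : ∀ {k m} → Vec Link k → Vec (Vec Bool m) k → Vec (Vec Bool (suc m)) k
addColumn = zipWith (λ l row → isIncoming l ∷ row)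

-- The new vertex is zero and the old vertex i becomes suc i.
extend : ∀ {n} → Adj n → Vec Link n → Adj (suc n)
extend A r = (false ∷ Vec.map isOutgoing r) ∷ addColumn r A

module _ {n} (A : Adj n) (r : Vec Link n) where

  lookup-extend-old-old : ∀ i j → lookup (lookup (extend A r) (suc i)) (suc j) ≡ lookup (lookup A i) j
  lookup-extend-old-old i j = cong (λ row → lookup row (suc j)) (lookup-zipWith _ i r A)

  lookup-extend-old-new : ∀ i → lookup (lookup (extend A r) (suc i)) zero ≡ isIncoming (lookup r i)
  lookup-extend-old-new i = cong (λ row → lookup row zero) (lookup-zipWith _ i r A)

  lookup-extend-new-old : ∀ j → lookup (lookup (extend A r) zero) (suc j) ≡ isOutgoing (lookup r j)
  lookup-extend-new-old j = lookup-map j isOutgoing r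

  extend-isDigraph : IsDigraph A → IsDigraph (extend A r)
  extend-isDigraph (irreflexive , asymmetric) = irreflexive′ , asymmetric′
    where
    not-outgoing-and-incoming : ∀ l → isOutgoing l ≡ true → isIncoming l ≢ true
    not-outgoing-and-incoming outgoing _ ()
    irreflexive′ : ∀ i → ¬ Arrow (extend A r) i i
    irreflexive′ zero    ()
    irreflexive′ (suc i) i→i = irreflexive i (trans (sym (lookup-extend-old-old i i)) i→i)
    asymmetric′ : ∀ i j → Arrow (extend A r) i j → ¬ Arrow (extend A r) j i
    asymmetric′ zero    zero    ()
    asymmetric′ zero    (suc j) 0→j j→0 =
      not-outgoing-and-incoming (lookup r j)
        (trans (sym (lookup-extend-new-old j)) 0→j) (trans (sym (lookup-extend-old-new j)) j→0)
    asymmetric′ (suc i) zero    i→0 0→i =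
      not-outgoing-and-incoming (lookup r i)
        (trans (sym (lookup-extend-new-old i)) 0→i) (trans (sym (lookup-extend-old-new i)) i→0)
    asymmetric′ (suc i) (suc j) i→j j→i =
      asymmetric i j (trans (sym (lookup-extend-old-old i j)) i→j) (trans (sym (lookup-extend-old-old j i)) j→i)

  extend-joined : ∀ j → lookup r j ≢ absent → Arrow (extend A r) zero (suc j) ⊎ Arrow (extend A r) (suc j) zero
  extend-joined j ≢absent with lookup r j in r[j]
  ... | outgoing = inj₁ (trans (lookup-extend-new-old j) (cong isOutgoing r[j]))
  ... | incoming = inj₂ (trans (lookup-extend-old-new j) (cong isIncoming r[j]))
  ... | absent   = ⊥-elim (≢absent refl)

  extend-inducesTournament : ∀ {c U} → InducesTournament A U → (c ≡ true → LinkedTo U r) →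
    InducesTournament (extend A r) (c ∷ U)
  extend-inducesTournament tU linked zero    zero    _               _               0≢0 = ⊥-elim (0≢0 refl)
  extend-inducesTournament tU linked zero    (suc j) Vec.here        (Vec.there j∈U) _   =
    extend-joined j (linked refl j j∈U)
  extend-inducesTournament tU linked (suc i) zero    (Vec.there i∈U) Vec.here        _   =
    swap (extend-joined i (linked refl i i∈U))
  extend-inducesTournament tU linked (suc i) (suc j) (Vec.there i∈U) (Vec.there j∈U) si≢sj
    with tU i j i∈U j∈U (λ i≡j → si≢sj (cong suc i≡j))
  ... | inj₁ i→j = inj₁ (trans (lookup-extend-old-old i j) i→j)
  ... | inj₂ j→i = inj₂ (trans (lookup-extend-old-old j i) j→i)

Splits : ∀ {n} → Adj n → Subset n → Set
Splits A S = InducesTournament A S × InducesTournament A (∁ S)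

extend-isBitournament : ∀ {n} {A : Adj n} {S r} → IsDigraph A → Splits A S → LinkedTo S r →
  IsBitournament (extend A r)
extend-isBitournament {A = A} {S} {r} digraph (tS , t∁S) linked =
  extend-isDigraph A r digraph , true ∷ S ,
  extend-inducesTournament A r tS (λ _ → linked) , extend-inducesTournament A r t∁S (λ ())

toLink : Bool → Bool → Link
toLink true  _     = outgoing
toLink false true  = incoming
toLink false false = absent

toLink-isOutgoing-isIncoming : ∀ l → toLink (isOutgoing l) (isIncoming l) ≡ l
toLink-isOutgoing-isIncoming outgoing = refl
toLink-isOutgoing-isIncoming incoming = refl
toLink-isOutgoing-isIncoming absent   = refl

restrict : ∀ {n} → Adj (suc n) → Adj n
restrict M = Vec.map tail (tail M)

linksOf : ∀ {n} → Adj (suc n) → Vec Link n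
linksOf M = zipWith toLink (tail (head M)) (Vec.map head (tail M))

map-tail-addColumn : ∀ {k m} (r : Vec Link k) (B : Vec (Vec Bool m) k) → Vec.map tail (addColumn r B) ≡ B
map-tail-addColumn []      []        = refl
map-tail-addColumn (l ∷ r) (row ∷ B) = cong (row ∷_) (map-tail-addColumn r B)

map-head-addColumn : ∀ {k m} (r : Vec Link k) (B : Vec (Vec Bool m) k) →
  Vec.map head (addColumn r B) ≡ Vec.map isIncoming r
map-head-addColumn []      []        = refl
map-head-addColumn (l ∷ r) (row ∷ B) = cong (isIncoming l ∷_) (map-head-addColumn r B)

zipWith-toLink : ∀ {k} (r : Vec Link k) → zipWith toLink (Vec.map isOutgoing r) (Vec.map isIncoming r) ≡ r
zipWith-toLink []      = refl
zipWith-toLink (l ∷ r) = cong₂ _∷_ (toLink-isOutgoing-isIncoming l) (zipWith-toLink r)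

restrict-extend : ∀ {n} (A : Adj n) r → restrict (extend A r) ≡ A
restrict-extend A r = map-tail-addColumn r A

linksOf-extend : ∀ {n} (A : Adj n) r → linksOf (extend A r) ≡ r
linksOf-extend A r = trans (cong (zipWith toLink _) (map-head-addColumn r A)) (zipWith-toLink r)

extend-injective : ∀ {n} {A A′ : Adj n} {r r′} → extend A r ≡ extend A′ r′ → A ≡ A′ × r ≡ r′
extend-injective {A = A} {A′} {r} {r′} eq =
  trans (sym (restrict-extend A r)) (trans (cong restrict eq) (restrict-extend A′ r′)) ,
  trans (sym (linksOf-extend A r)) (trans (cong linksOf eq) (linksOf-extend A′ r′))

∁-involutive : ∀ {n} (S : Subset n) → ∁ (∁ S) ≡ S
∁-involutive []      = refl
∁-involutive (s ∷ S) = cong₂ _∷_ (not-involutive s) (∁-involutive S)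

Splits-∁ : ∀ {n} {A : Adj n} {S} → Splits A S → Splits A (∁ S)
Splits-∁ {A = A} {S} (tS , t∁S) = t∁S , subst (InducesTournament A) (sym (∁-involutive S)) tS

-- Some split witnessing that A is a bitournament (junk if A is none).
partition : ∀ {n} → Adj n → Subset n
partition A with isBitournament? A
... | yes (_ , S , _) = S
... | no _            = replicate _ false

partition-splits : ∀ {n} {A : Adj n} → IsBitournament A → Splits A (partition A)
partition-splits {A = A} bitournament with isBitournament? A
... | yes (_ , _ , splits) = splits
... | no ¬bitournament     = ⊥-elim (¬bitournament bitournament)

widerSide : ∀ {n} → Subset n → Subset n
widerSide S with length (linkings (∁ S)) ≤? length (linkings S)
... | yes _ = S
... | no _  = ∁ S

widerSide-splits : ∀ {n} {A : Adj n} {S} → Splits A S → Splits A (widerSide S)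
widerSide-splits {A = A} {S} splits with length (linkings (∁ S)) ≤? length (linkings S)
... | yes _ = splits
... | no _  = Splits-∁ {A = A} splits

6^n≤length-linkings-widerSide² : ∀ {n} (S : Subset n) →
  6 ^ n ≤ length (linkings (widerSide S)) * length (linkings (widerSide S))
6^n≤length-linkings-widerSide² S with length (linkings (∁ S)) ≤? length (linkings S)
... | yes ∁S≤S = ≤-square-of-larger-factor (length-linkings-∁ S) ∁S≤S
... | no  ∁S≰S = ≤-square-of-larger-factor
  (trans (*-comm (length (linkings (∁ S))) _) (length-linkings-∁ S)) (<⇒≤ (≰⇒> ∁S≰S))

extensions : ∀ {n} → Adj n → List (Adj (suc n))
extensions A = map (extend A) (linkings (widerSide (partition A)))

6^n≤length-extensions² : ∀ {n} (A : Adj n) → 6 ^ n ≤ length (extensions A) * length (extensions A)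
6^n≤length-extensions² {n} A =
  subst (λ k → 6 ^ n ≤ k * k) (sym (length-map (extend A) (linkings (widerSide (partition A)))))
    (6^n≤length-linkings-widerSide² (partition A))

extensions-⊆ : ∀ {n} {A : Adj n} → A ∈ₗ bitournaments n → extensions A ⊆ bitournaments (suc n)
extensions-⊆ {n} {A} A∈ M∈ with ∈-map⁻ (extend A) M∈ | ∈-filter⁻ isBitournament? {xs = allAdj n} A∈
... | r , r∈ , refl | _ , bitournament@(digraph , _) =
  ∈-filter⁺ isBitournament? (∈-allAdj (extend A r))
    (extend-isBitournament digraph (widerSide-splits {A = A} (partition-splits {A = A} bitournament))
      (∈-linkings⇒LinkedTo (widerSide (partition A)) r∈))

Unique-extensions : ∀ n → Unique (concatMap extensions (bitournaments n))
Unique-extensions n =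
  Unique-concatMap⁺ extensions (Unique.filter⁺ isBitournament? (Unique-allAdj n))
    (λ A → Unique.map⁺ (λ eq → proj₂ (extend-injective {A = A} eq)) (Unique-linkings (widerSide (partition A))))
    different-bases
  where
  different-bases : ∀ {A B M} → M ∈ₗ extensions A → M ∈ₗ extensions B → A ≡ B
  different-bases {A} {B} M∈A M∈B with ∈-map⁻ (extend A) M∈A | ∈-map⁻ (extend B) M∈B
  ... | _ , _ , refl | _ , _ , eq = proj₁ (extend-injective eq)

length-extensions≤ : ∀ n → length (concatMap extensions (bitournaments n)) ≤ numBitournaments (suc n)
length-extensions≤ n = Unique-⊆⇒length≤ (Unique-extensions n) λ M∈ →
  let A , A∈ , M∈A = find (∈-concatMap⁻ extensions {xs = bitournaments n} M∈) in extensions-⊆ A∈ M∈A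

square : ∀ x → x ^ 2 ≡ x * x
square x = cong (x *_) (*-identityʳ x)

mainTheorem6 : ∀ (n : ℕ) → 1 ≤ n →
    6 ^ n * (numBitournaments n ^ 2) ≤ numBitournaments (suc n) ^ 2
mainTheorem6 n _ = begin
  6 ^ n * T ^ 2         ≡⟨ cong (6 ^ n *_) (square T) ⟩
  6 ^ n * (T * T)       ≤⟨ sum-square-≥ (6 ^ n) (length ∘ extensions) (bitournaments n) 6^n≤length-extensions² ⟩
  Σ * Σ                 ≡⟨ cong (λ k → k * k) (length-concatMap extensions (bitournaments n)) ⟨
  L * L                 ≤⟨ *-mono-≤ (length-extensions≤ n) (length-extensions≤ n) ⟩
  T′ * T′               ≡⟨ square T′ ⟨
  T′ ^ 2                ∎
  where
  open ≤-Reasoning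
  T  = numBitournaments n
  T′ = numBitournaments (suc n)
  L  = length (concatMap extensions (bitournaments n))
  Σ  = sum (map (length ∘ extensions) (bitournaments n))
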